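{- Let $t:\mathbb{N}\to\{ -1,1\}$ be the completely multiplicative function with $t_3=1$, $t_p=-1$ for primes $p\equiv 2\pmod 3$, and $t_p=1$ for primes $p\equiv 1\pmod 3$, and let $T(z)=\sum_{n=1}^\infty t_nz^n$ for $|z|<1$. Then $$T(z^3)=T(z)-\frac{z}{1+z+z^2}.$$
   Context: $t_n$ denotes $t(n)$. -}

module Defs where

open import Data.Nat as ℕ using (ℕ; zero; suc; _%_; _/_)
open import Data.Nat.Divisibility using (_∣?_)
open import Data.Nat.Primality using (Prime)
open import Data.Integer as ℤ using (ℤ; +_; -_; _+_; _*_; _-_)
open import Data.List using (List; map; foldr; upTo)
open import Data.Product using (_×_)
open import Data.Sum using (_⊎_)
open import Relation.Nullary using (yes; no)
open import Relation.Binary.PropositionalEquality using (_≡_)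

FPS : Set
FPS = ℕ → ℤ

sumℤ : List ℤ → ℤ
sumℤ = foldr _+_ (+ 0)

_⊛_ : FPS → FPS → FPS
(f ⊛ g) n = sumℤ (map (λ k → f k * g (n ℕ.∸ k)) (upTo (suc n)))

_⊝_ : FPS → FPS → FPS
(f ⊝ g) n = f n - g n

cubeSubst : FPS → FPS
cubeSubst f n with 3 ∣? n
... | yes _ = f (n / 3)
... | no  _ = + 0

zSeries : FPS
zSeries 1 = + 1
zSeries _ = + 0

onePlusZPlusZ² : FPS
onePlusZPlusZ² 0 = + 1
onePlusZPlusZ² 1 = + 1
onePlusZPlusZ² 2 = + 1
onePlusZPlusZ² _ = + 0

TSeries : (ℕ → ℤ) → FPS
TSeries t zero    = + 0
TSeries t (suc n) = t (suc n)

-- t is only constrained on positive integers (t 0 is irrelevant).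
-- t : ℕ⁺ → {-1,1} completely multiplicative with the prescribed prime values.
IsT : (ℕ → ℤ) → Set
IsT t =
  (∀ n → (t (suc n) ≡ + 1) ⊎ (t (suc n) ≡ - (+ 1))) ×
  (t 1 ≡ + 1) ×
  (∀ m n → t (suc m ℕ.* suc n) ≡ t (suc m) * t (suc n)) ×
  (t 3 ≡ + 1) ×
  (∀ p → Prime p → p % 3 ≡ 2 → t p ≡ - (+ 1)) ×
  (∀ p → Prime p → p % 3 ≡ 1 → t p ≡ + 1)

-- On exponents prime to 3, t agrees with the non-principal character χ₃ modulo 3: both are
-- completely multiplicative and they agree on primes. On multiples of 3, t(3k) = t(k). Hence
-- T(z) = T(z³) + Σ χ₃(n) zⁿ, and multiplying by 1 + z + z² kills the periodic part up to the
-- first term: Σ χ₃(n) zⁿ · (1 + z + z²) = z, because χ₃ sums to 0 over every window of three.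
module Submission where

open import Defs
open import Data.Nat as ℕ using (ℕ; zero; suc; _%_; _/_; _<_; s≤s; s<s⁻¹)
open import Data.Nat.DivMod using (m%n<n; %-distribˡ-*; [m+n]%n≡m%n; m*n%n≡0; m*n/n≡m)
open import Data.Nat.Divisibility using (_∤_; divides; _∣?_; m%n≡0⇒n∣m; ∣m⇒∣m*n; ∣n⇒∣m*n; quotient-<)
open import Data.Nat.Induction using (<-rec)
open import Data.Nat.Primality using (Prime; prime?; ¬prime⇒composite)
open import Data.Nat.Divisibility.Core using (hasNonTrivialDivisor)
import Data.Nat.Properties as ℕ
open import Data.Integer using (ℤ; +_; -_; _+_; _*_; _-_)
import Data.Integer.Properties as ℤ
open import Algebra.Properties.CommutativeSemigroup ℤ.+-commutativeSemigroup using () renaming (interchange to +-interchange)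
open import Data.Integer.Tactic.RingSolver using (solve-∀)
open import Data.List using ([]; _∷_; map; upTo; applyUpTo)
open import Data.List.Properties using (map-cong; map-upTo)
open import Data.Product using (_×_; _,_; proj₁; proj₂)
open import Data.Empty using (⊥-elim)
open import Function using (_∘_)
open import Relation.Nullary using (yes; no)
open import Relation.Binary.PropositionalEquality using (_≡_; refl; sym; trans; cong; cong₂; subst; module ≡-Reasoning)

open ≡-Reasoning

_⊕_ : FPS → FPS → FPS
(f ⊕ g) n = f n + g n

sumℤ-map-⊕ : ∀ (f g : ℕ → ℤ) xs → sumℤ (map (f ⊕ g) xs) ≡ sumℤ (map f xs) + sumℤ (map g xs)
sumℤ-map-⊕ f g []       = refl
sumℤ-map-⊕ f g (x ∷ xs) =
  trans (cong (_+_ (f x + g x)) (sumℤ-map-⊕ f g xs)) (+-interchange (f x) (g x) _ _)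

⊛-distribʳ-⊕ : ∀ f g h n → ((f ⊕ g) ⊛ h) n ≡ (f ⊛ h) n + (g ⊛ h) n
⊛-distribʳ-⊕ f g h n = trans
  (cong sumℤ (map-cong (λ k → ℤ.*-distribʳ-+ (h (n ℕ.∸ k)) (f k) (g k)) (upTo (suc n))))
  (sumℤ-map-⊕ (λ k → f k * h (n ℕ.∸ k)) (λ k → g k * h (n ℕ.∸ k)) (upTo (suc n)))

⊛-congˡ : ∀ {f g} → (∀ n → f n ≡ g n) → ∀ h n → (f ⊛ h) n ≡ (g ⊛ h) n
⊛-congˡ f≗g h n = cong sumℤ (map-cong (λ k → cong (_* h (n ℕ.∸ k)) (f≗g k)) (upTo (suc n)))

⊛-suc : ∀ f g n → (f ⊛ g) (suc n) ≡ f 0 * g (suc n) + ((f ∘ suc) ⊛ g) n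
⊛-suc f g n = begin
  (f ⊛ g) (suc n)                                   ≡⟨ cong sumℤ (map-upTo (λ k → f k * g (suc n ℕ.∸ k)) (suc (suc n))) ⟩
  f 0 * g (suc n) + sumℤ (applyUpTo (λ k → f (suc k) * g (n ℕ.∸ k)) (suc n))
                                                    ≡⟨ cong (_+_ (f 0 * g (suc n)) ∘ sumℤ) (map-upTo (λ k → f (suc k) * g (n ℕ.∸ k)) (suc n)) ⟨
  f 0 * g (suc n) + ((f ∘ suc) ⊛ g) n               ∎

⊛-onePlusZPlusZ² : ∀ f n → (f ⊛ onePlusZPlusZ²) (2 ℕ.+ n) ≡ f n + f (1 ℕ.+ n) + f (2 ℕ.+ n)
⊛-onePlusZPlusZ² f zero    = trim (f 0) (f 1) (f 2)
  where
  trim : ∀ a b c → a * + 1 + (b * + 1 + (c * + 1 + + 0)) ≡ a + b + c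
  trim = solve-∀
⊛-onePlusZPlusZ² f (suc n) = begin
  (f ⊛ onePlusZPlusZ²) (3 ℕ.+ n)                            ≡⟨ ⊛-suc f onePlusZPlusZ² (2 ℕ.+ n) ⟩
  f 0 * + 0 + ((f ∘ suc) ⊛ onePlusZPlusZ²) (2 ℕ.+ n)        ≡⟨ cong (_+ ((f ∘ suc) ⊛ onePlusZPlusZ²) (2 ℕ.+ n)) (ℤ.*-zeroʳ (f 0)) ⟩
  + 0 + ((f ∘ suc) ⊛ onePlusZPlusZ²) (2 ℕ.+ n)              ≡⟨ ℤ.+-identityˡ _ ⟩
  ((f ∘ suc) ⊛ onePlusZPlusZ²) (2 ℕ.+ n)                    ≡⟨ ⊛-onePlusZPlusZ² (f ∘ suc) n ⟩
  f (1 ℕ.+ n) + f (2 ℕ.+ n) + f (3 ℕ.+ n)                   ∎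

CompletelyMultiplicative : (ℕ → ℤ) → Set
CompletelyMultiplicative f = ∀ m n → f (suc m ℕ.* suc n) ≡ f (suc m) * f (suc n)

module _ {f g : ℕ → ℤ} (P : ℕ → Set) (P-factors : ∀ m n → P (m ℕ.* n) → P m × P n)
         (f-mult : CompletelyMultiplicative f) (g-mult : CompletelyMultiplicative g)
         (f1≡g1 : f 1 ≡ g 1) (f≡g-on-primes : ∀ p → Prime p → P p → f p ≡ g p) where

  multiplicative-agree : ∀ n → P (suc n) → f (suc n) ≡ g (suc n)
  multiplicative-agree = <-rec _ step
    where
    step : ∀ n → (∀ {m} → m < n → P (suc m) → f (suc m) ≡ g (suc m)) → P (suc n) → f (suc n) ≡ g (suc n)
    step zero _ _ = f1≡g1
    step n@(suc _) ih Pn with prime? (suc n)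
    ... | yes n-prime = f≡g-on-primes _ n-prime Pn
    ... | no ¬prime with ¬prime⇒composite ¬prime
    ...   | hasNonTrivialDivisor {suc (suc d)} d<n d∣n@(divides (suc q) eq) = begin
      f (suc n)                      ≡⟨ cong f eq ⟩
      f (suc q ℕ.* suc (suc d))      ≡⟨ f-mult q (suc d) ⟩
      f (suc q) * f (suc (suc d))    ≡⟨ cong₂ _*_ (ih q<n (proj₁ Pq×Pd)) (ih (s<s⁻¹ d<n) (proj₂ Pq×Pd)) ⟩
      g (suc q) * g (suc (suc d))    ≡⟨ g-mult q (suc d) ⟨
      g (suc q ℕ.* suc (suc d))      ≡⟨ cong g eq ⟨
      g (suc n)                      ∎
      where
      q<n : q < n
      q<n = s<s⁻¹ (quotient-< d∣n)
      Pq×Pd : P (suc q) × P (suc (suc d))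
      Pq×Pd = P-factors (suc q) (suc (suc d)) (subst P eq Pn)

residueCharacter : ℕ → ℤ
residueCharacter 1 = + 1
residueCharacter 2 = - + 1
residueCharacter _ = + 0

χ₃ : ℕ → ℤ
χ₃ n = residueCharacter (n % 3)

residueCharacter-* : ∀ a b → a < 3 → b < 3 →
  residueCharacter ((a ℕ.* b) % 3) ≡ residueCharacter a * residueCharacter b
residueCharacter-* 0 0 _ _ = refl
residueCharacter-* 0 1 _ _ = refl
residueCharacter-* 0 2 _ _ = refl
residueCharacter-* 1 0 _ _ = refl
residueCharacter-* 1 1 _ _ = refl
residueCharacter-* 1 2 _ _ = refl
residueCharacter-* 2 0 _ _ = refl
residueCharacter-* 2 1 _ _ = refl
residueCharacter-* 2 2 _ _ = refl
residueCharacter-* (suc (suc (suc _))) _ (s≤s (s≤s (s≤s ()))) _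
residueCharacter-* _ (suc (suc (suc _))) _ (s≤s (s≤s (s≤s ())))

χ₃-* : ∀ m n → χ₃ (m ℕ.* n) ≡ χ₃ m * χ₃ n
χ₃-* m n = begin
  residueCharacter ((m ℕ.* n) % 3)               ≡⟨ cong residueCharacter (%-distribˡ-* m n 3) ⟩
  residueCharacter ((m % 3 ℕ.* (n % 3)) % 3)     ≡⟨ residueCharacter-* _ _ (m%n<n m 3) (m%n<n n 3) ⟩
  χ₃ m * χ₃ n                                    ∎

χ₃-periodic : ∀ n → χ₃ (3 ℕ.+ n) ≡ χ₃ n
χ₃-periodic n = cong residueCharacter (trans (cong (_% 3) (ℕ.+-comm 3 n)) ([m+n]%n≡m%n n 3))

χ₃-window : ∀ n → χ₃ n + χ₃ (1 ℕ.+ n) + χ₃ (2 ℕ.+ n) ≡ + 0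
χ₃-window zero    = refl
χ₃-window (suc n) = begin
  χ₃ (1 ℕ.+ n) + χ₃ (2 ℕ.+ n) + χ₃ (3 ℕ.+ n)   ≡⟨ cong (_+_ (χ₃ (1 ℕ.+ n) + χ₃ (2 ℕ.+ n))) (χ₃-periodic n) ⟩
  χ₃ (1 ℕ.+ n) + χ₃ (2 ℕ.+ n) + χ₃ n           ≡⟨ rotate (χ₃ n) (χ₃ (1 ℕ.+ n)) (χ₃ (2 ℕ.+ n)) ⟩
  χ₃ n + χ₃ (1 ℕ.+ n) + χ₃ (2 ℕ.+ n)           ≡⟨ χ₃-window n ⟩
  + 0                                          ∎
  where
  rotate : ∀ a b c → b + c + a ≡ a + b + c
  rotate = solve-∀

χ₃⊛onePlusZPlusZ²≡zSeries : ∀ n → (χ₃ ⊛ onePlusZPlusZ²) n ≡ zSeries n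
χ₃⊛onePlusZPlusZ²≡zSeries 0             = refl
χ₃⊛onePlusZPlusZ²≡zSeries 1             = refl
χ₃⊛onePlusZPlusZ²≡zSeries (suc (suc n)) = trans (⊛-onePlusZPlusZ² χ₃ n) (χ₃-window n)

3∤-factors : ∀ m n → 3 ∤ m ℕ.* n → 3 ∤ m × 3 ∤ n
3∤-factors m n 3∤mn = (λ 3∣m → 3∤mn (∣m⇒∣m*n n 3∣m)) , (λ 3∣n → 3∤mn (∣n⇒∣m*n m 3∣n))

module _ {t : ℕ → ℤ} (isT : IsT t) where
  private
    t1≡1 : t 1 ≡ + 1
    t1≡1 = proj₁ (proj₂ isT)
    t-mult : CompletelyMultiplicative t
    t-mult = proj₁ (proj₂ (proj₂ isT))
    t3≡1 : t 3 ≡ + 1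
    t3≡1 = proj₁ (proj₂ (proj₂ (proj₂ isT)))
    t[p≡2]≡-1 : ∀ p → Prime p → p % 3 ≡ 2 → t p ≡ - + 1
    t[p≡2]≡-1 = proj₁ (proj₂ (proj₂ (proj₂ (proj₂ isT))))
    t[p≡1]≡1 : ∀ p → Prime p → p % 3 ≡ 1 → t p ≡ + 1
    t[p≡1]≡1 = proj₂ (proj₂ (proj₂ (proj₂ (proj₂ isT))))

  t≡χ₃-on-primes : ∀ p → Prime p → 3 ∤ p → t p ≡ χ₃ p
  t≡χ₃-on-primes p p-prime 3∤p with p % 3 in p%3 | m%n<n p 3
  ... | 0 | _ = ⊥-elim (3∤p (m%n≡0⇒n∣m p 3 p%3))
  ... | 1 | _ = t[p≡1]≡1 p p-prime p%3
  ... | 2 | _ = t[p≡2]≡-1 p p-prime p%3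
  ... | suc (suc (suc _)) | s≤s (s≤s (s≤s ()))

  t≡χ₃ : ∀ n → 3 ∤ suc n → t (suc n) ≡ χ₃ (suc n)
  t≡χ₃ = multiplicative-agree (3 ∤_) 3∤-factors t-mult (λ m n → χ₃-* (suc m) (suc n)) t1≡1 t≡χ₃-on-primes

  TSeries-*3 : ∀ k → TSeries t (k ℕ.* 3) ≡ TSeries t k
  TSeries-*3 zero    = refl
  TSeries-*3 (suc k) = begin
    t (suc k ℕ.* 3)   ≡⟨ t-mult k 2 ⟩
    t (suc k) * t 3   ≡⟨ cong (t (suc k) *_) t3≡1 ⟩
    t (suc k) * + 1   ≡⟨ ℤ.*-identityʳ (t (suc k)) ⟩
    t (suc k)         ∎

  TSeries≡χ₃ : ∀ n → 3 ∤ n → TSeries t n ≡ χ₃ n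
  TSeries≡χ₃ zero    3∤0   = ⊥-elim (3∤0 (divides 0 refl))
  TSeries≡χ₃ (suc n) 3∤1+n = t≡χ₃ n 3∤1+n

  TSeries≡cubeSubst+χ₃ : ∀ n → TSeries t n ≡ cubeSubst (TSeries t) n + χ₃ n
  TSeries≡cubeSubst+χ₃ n with 3 ∣? n
  ... | yes (divides k refl) = begin
    TSeries t (k ℕ.* 3)                             ≡⟨ TSeries-*3 k ⟩
    TSeries t k                                     ≡⟨ cong (TSeries t) (m*n/n≡m k 3) ⟨
    TSeries t (k ℕ.* 3 / 3)                         ≡⟨ ℤ.+-identityʳ _ ⟨
    TSeries t (k ℕ.* 3 / 3) + + 0                   ≡⟨ cong (_+_ (TSeries t (k ℕ.* 3 / 3)) ∘ residueCharacter) (m*n%n≡0 k 3) ⟨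
    TSeries t (k ℕ.* 3 / 3) + χ₃ (k ℕ.* 3)          ∎
  ... | no 3∤n = trans (TSeries≡χ₃ n 3∤n) (sym (ℤ.+-identityˡ (χ₃ n)))

mainTheorem3 : (t : ℕ → ℤ) → IsT t →
    ∀ n → (cubeSubst (TSeries t) ⊛ onePlusZPlusZ²) n
          ≡ ((TSeries t ⊛ onePlusZPlusZ²) ⊝ zSeries) n
mainTheorem3 t isT n = begin
  (cubeSubst T ⊛ c) n                                ≡⟨ x≡x+y-y ((cubeSubst T ⊛ c) n) (zSeries n) ⟩
  (cubeSubst T ⊛ c) n + zSeries n - zSeries n        ≡⟨ cong (λ y → (cubeSubst T ⊛ c) n + y - zSeries n) (χ₃⊛onePlusZPlusZ²≡zSeries n) ⟨
  (cubeSubst T ⊛ c) n + (χ₃ ⊛ c) n - zSeries n       ≡⟨ cong (_- zSeries n) (⊛-distribʳ-⊕ (cubeSubst T) χ₃ c n) ⟨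
  ((cubeSubst T ⊕ χ₃) ⊛ c) n - zSeries n             ≡⟨ cong (_- zSeries n) (⊛-congˡ (TSeries≡cubeSubst+χ₃ isT) c n) ⟨
  (T ⊛ c) n - zSeries n                              ∎
  where
  T = TSeries t
  c = onePlusZPlusZ²
  x≡x+y-y : ∀ x y → x ≡ x + y - y
  x≡x+y-y = solve-∀
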